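{- Let $T$ be any recursively enumerable extension of $\mathsf{PA}(\mathsf{K4})$. (1) If $T$ has MDP, then $T$ has $\Sigma_1(\Box)$-DP. (2) If $T$ has MEP, then $T$ has $\Sigma_1(\Box)$-EP.
   Context: $\mathcal{L}_A(\Box)$ is the language of arithmetic $\{0,S,+,\times,\le,=\}$ plus a unary modal operator $\Box$; derivations use modus ponens, generalization and necessitation (from $\varphi$ infer $\Box\varphi$). $\mathsf{PA}_\Box$ is Peano arithmetic plus first-order logical axioms for $\mathcal{L}_A(\Box)$-formulas (including universal instantiation for $\mathcal{L}_A$-terms) and induction for all $\mathcal{L}_A(\Box)$-formulas; $\mathsf{PA}(\mathsf{K4})$ adds universal closures of all $\Box(\varphi\to\psi)\to(\Box\varphi\to\Box\psi)$ and $\Box\varphi\to\Box\Box\varphi$. $\Sigma_1(\Box)$ is the smallest class containing arithmetic $\Sigma_1$ formulas and all $\Box\varphi$, closed under $\land,\lor,\exists x,\forall x<t$ ($t$ an $\mathcal{L}_A$-term not containing $x$). $T$ has the modal disjunction property (MDP) if for all sentences $\varphi,\psi$, $T\vdash\Box\varphi\lor\Box\psi$ implies $T\vdash\varphi$ or $T\vdash\psi$; $T$ has the modal existence property (MEP) if for every formula $\varphi(x)$ with no free variables other than $x$, $T\vdash\exists x\Box\varphi(x)$ implies $T\vdash\varphi(\overline n)$ for some natural number $n$. $T$ has $\Sigma_1(\Box)$-DP if for $\Sigma_1(\Box)$ sentences $\varphi,\psi$, $T\vdash\varphi\lor\psi$ implies $T\vdash\varphi$ or $T\vdash\psi$; $\Sigma_1(\Box)$-EP: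 for every $\Sigma_1(\Box)$ formula $\varphi(x)$ with no free variables other than $x$, $T\vdash\exists x\varphi(x)$ implies $T\vdash\varphi(\overline n)$ for some $n$. -}

module Defs where

open import Data.Nat using (ℕ; zero; suc)
open import Data.Fin using (Fin; zero; suc)
open import Data.Maybe using (Maybe; just)
open import Data.Product using (Σ; ∃; _×_; _,_)
open import Data.Sum using (_⊎_)
open import Relation.Binary.PropositionalEquality using (_≡_)

-- Syntax of L_A(□), well-scoped de Bruijn: Term n / Form n have their
-- free variables among Fin n (var zero = innermost bound variable).

infixl 9 _⊕_
infixl 10 _⊗_
infix 7 _≐_ _≼_
infixr 6 _∧'_
infixr 5 _∨'_
infixr 4 _⇒_
infix 2 _⊢_

data Term (n : ℕ) : Set where
  var : Fin n → Term n
  𝟎   : Term n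
  S   : Term n → Term n
  _⊕_ : Term n → Term n → Term n
  _⊗_ : Term n → Term n → Term n

data Form : ℕ → Set where
  _≐_  : ∀ {n} → Term n → Term n → Form n
  _≼_  : ∀ {n} → Term n → Term n → Form n
  ⊥'   : ∀ {n} → Form n
  _⇒_  : ∀ {n} → Form n → Form n → Form n
  _∧'_ : ∀ {n} → Form n → Form n → Form n
  _∨'_ : ∀ {n} → Form n → Form n → Form n
  ∀'   : ∀ {n} → Form (suc n) → Form n
  ∃'   : ∀ {n} → Form (suc n) → Form n
  □    : ∀ {n} → Form n → Form n

Sentence : Set
Sentence = Form 0

renT : ∀ {n m} → (Fin n → Fin m) → Term n → Term m
renT ρ (var i) = var (ρ i)
renT ρ 𝟎 = 𝟎
renT ρ (S t) = S (renT ρ t)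
renT ρ (t ⊕ u) = renT ρ t ⊕ renT ρ u
renT ρ (t ⊗ u) = renT ρ t ⊗ renT ρ u

wkT : ∀ {n} → Term n → Term (suc n)
wkT = renT suc

substT : ∀ {n m} → (Fin n → Term m) → Term n → Term m
substT σ (var i) = σ i
substT σ 𝟎 = 𝟎
substT σ (S t) = S (substT σ t)
substT σ (t ⊕ u) = substT σ t ⊕ substT σ u
substT σ (t ⊗ u) = substT σ t ⊗ substT σ u

exts : ∀ {n m} → (Fin n → Term m) → Fin (suc n) → Term (suc m)
exts σ zero = var zero
exts σ (suc i) = wkT (σ i)

subst : ∀ {n m} → (Fin n → Term m) → Form n → Form m
subst σ (t ≐ u) = substT σ t ≐ substT σ u
subst σ (t ≼ u) = substT σ t ≼ substT σ u
subst σ ⊥' = ⊥'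
subst σ (φ ⇒ ψ) = subst σ φ ⇒ subst σ ψ
subst σ (φ ∧' ψ) = subst σ φ ∧' subst σ ψ
subst σ (φ ∨' ψ) = subst σ φ ∨' subst σ ψ
subst σ (∀' φ) = ∀' (subst (exts σ) φ)
subst σ (∃' φ) = ∃' (subst (exts σ) φ)
subst σ (□ φ) = □ (subst σ φ)

wk : ∀ {n} → Form n → Form (suc n)
wk = subst (λ i → var (suc i))

emb : ∀ {n} → Sentence → Form n
emb = subst (λ ())

single : ∀ {n} → Term n → Fin (suc n) → Term n
single t zero = t
single t (suc i) = var i

inst : ∀ {n} → Form (suc n) → Term n → Form n
inst φ t = subst (single t) φ

num : ∀ {n} → ℕ → Term n
num zero = 𝟎
num (suc k) = S (num k)

close : ∀ {n} → Form n → Sentence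
close {zero} φ = φ
close {suc n} φ = close (∀' φ)

data LogAx : ∀ {n} → Form n → Set where
  ax-K   : ∀ {n} {φ ψ : Form n} → LogAx (φ ⇒ ψ ⇒ φ)
  ax-S   : ∀ {n} {φ ψ χ : Form n} → LogAx ((φ ⇒ ψ ⇒ χ) ⇒ (φ ⇒ ψ) ⇒ φ ⇒ χ)
  ax-∧I  : ∀ {n} {φ ψ : Form n} → LogAx (φ ⇒ ψ ⇒ φ ∧' ψ)
  ax-∧E₁ : ∀ {n} {φ ψ : Form n} → LogAx (φ ∧' ψ ⇒ φ)
  ax-∧E₂ : ∀ {n} {φ ψ : Form n} → LogAx (φ ∧' ψ ⇒ ψ)
  ax-∨I₁ : ∀ {n} {φ ψ : Form n} → LogAx (φ ⇒ φ ∨' ψ)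
  ax-∨I₂ : ∀ {n} {φ ψ : Form n} → LogAx (ψ ⇒ φ ∨' ψ)
  ax-∨E  : ∀ {n} {φ ψ χ : Form n} → LogAx ((φ ⇒ χ) ⇒ (ψ ⇒ χ) ⇒ φ ∨' ψ ⇒ χ)
  ax-⊥E  : ∀ {n} {φ : Form n} → LogAx (⊥' ⇒ φ)
  ax-DN  : ∀ {n} {φ : Form n} → LogAx (((φ ⇒ ⊥') ⇒ ⊥') ⇒ φ)
  ax-∀E  : ∀ {n} {φ : Form (suc n)} {t : Term n} → LogAx (∀' φ ⇒ inst φ t)
  -- ∀x(ψ → φ) → (ψ → ∀xφ), x not free in ψ
  ax-∀I  : ∀ {n} {ψ : Form n} {φ : Form (suc n)} → LogAx (∀' (wk ψ ⇒ φ) ⇒ ψ ⇒ ∀' φ)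
  ax-∃I  : ∀ {n} {φ : Form (suc n)} {t : Term n} → LogAx (inst φ t ⇒ ∃' φ)
  -- ∀x(φ → ψ) → (∃xφ → ψ), x not free in ψ
  ax-∃E  : ∀ {n} {φ : Form (suc n)} {ψ : Form n} → LogAx (∀' (φ ⇒ wk ψ) ⇒ ∃' φ ⇒ ψ)
  ax-refl : ∀ {n} {t : Term n} → LogAx (t ≐ t)
  ax-Leib : ∀ {n} {φ : Form (suc n)} {t u : Term n} → LogAx (t ≐ u ⇒ inst φ t ⇒ inst φ u)

data _⊢_ (T : Sentence → Set) : {n : ℕ} → Form n → Set where
  byLog : ∀ {n} {φ : Form n} → LogAx φ → T ⊢ φ
  byAx  : ∀ {n} {φ : Sentence} → T φ → T ⊢ emb {n} φ
  mp    : ∀ {n} {φ ψ : Form n} → T ⊢ φ ⇒ ψ → T ⊢ φ → T ⊢ ψ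
  gen   : ∀ {n} {φ : Form (suc n)} → T ⊢ φ → T ⊢ ∀' φ
  nec   : ∀ {n} {φ : Form n} → T ⊢ φ → T ⊢ □ φ

private
  x0 : ∀ {n} → Term (suc n)
  x0 = var zero
  x1 : ∀ {n} → Term (suc (suc n))
  x1 = var (suc zero)

induction : ∀ {n} → Form (suc n) → Form n
induction φ =
  inst φ 𝟎 ∧' ∀' (φ ⇒ subst (λ { zero → S (var zero) ; (suc i) → var (suc i) }) φ)
  ⇒ ∀' φ

data PAK4Ax : Sentence → Set where
  pa-S≠0  : PAK4Ax (∀' (S x0 ≐ 𝟎 ⇒ ⊥'))
  pa-Sinj : PAK4Ax (∀' (∀' (S x1 ≐ S x0 ⇒ x1 ≐ x0)))
  pa-+0   : PAK4Ax (∀' (x0 ⊕ 𝟎 ≐ x0))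
  pa-+S   : PAK4Ax (∀' (∀' (x1 ⊕ S x0 ≐ S (x1 ⊕ x0))))
  pa-×0   : PAK4Ax (∀' (x0 ⊗ 𝟎 ≐ 𝟎))
  pa-×S   : PAK4Ax (∀' (∀' (x1 ⊗ S x0 ≐ x1 ⊗ x0 ⊕ x1)))
  -- x ≤ y ↔ ∃z (x + z = y)
  pa-≤    : PAK4Ax (∀' (∀' ((x1 ≼ x0 ⇒ ∃' (var (suc (suc zero)) ⊕ var zero ≐ var (suc zero)))
                          ∧' (∃' (var (suc (suc zero)) ⊕ var zero ≐ var (suc zero)) ⇒ x1 ≼ x0))))
  pa-ind  : ∀ {n} {φ : Form (suc n)} → PAK4Ax (close (induction φ))
  k4-K    : ∀ {n} {φ ψ : Form n} → PAK4Ax (close (□ (φ ⇒ ψ) ⇒ □ φ ⇒ □ ψ))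
  k4-4    : ∀ {n} {φ : Form n} → PAK4Ax (close (□ φ ⇒ □ (□ φ)))

ExtendsPAK4 : (Sentence → Set) → Set
ExtendsPAK4 T = ∀ φ → PAK4Ax φ → T ⊢ φ

-- T (its set of axioms) is recursively enumerable: enumerated by a
-- (necessarily computable) Agda function
RE : (Sentence → Set) → Set
RE T = Σ (ℕ → Maybe Sentence) λ e →
         ∀ φ → (T φ → ∃ λ k → e k ≡ just φ) × ((∃ λ k → e k ≡ just φ) → T φ)

-- x < t  abbreviates  S x ≤ t
-- ∀x<t φ and ∃x<t φ, with t not containing x (t lives in the outer context)
∀<' : ∀ {n} → Term n → Form (suc n) → Form n
∀<' t φ = ∀' (S (var zero) ≼ wkT t ⇒ φ)

∃<' : ∀ {n} → Term n → Form (suc n) → Form n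
∃<' t φ = ∃' (S (var zero) ≼ wkT t ∧' φ)

data Δ0 : {n : ℕ} → Form n → Set where
  d-≐ : ∀ {n} {t u : Term n} → Δ0 (t ≐ u)
  d-≼ : ∀ {n} {t u : Term n} → Δ0 (t ≼ u)
  d-⊥ : ∀ {n} → Δ0 (⊥' {n})
  d-⇒ : ∀ {n} {φ ψ : Form n} → Δ0 φ → Δ0 ψ → Δ0 (φ ⇒ ψ)
  d-∧ : ∀ {n} {φ ψ : Form n} → Δ0 φ → Δ0 ψ → Δ0 (φ ∧' ψ)
  d-∨ : ∀ {n} {φ ψ : Form n} → Δ0 φ → Δ0 ψ → Δ0 (φ ∨' ψ)
  d-∀< : ∀ {n} {t : Term n} {φ : Form (suc n)} → Δ0 φ → Δ0 (∀<' t φ)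
  d-∃< : ∀ {n} {t : Term n} {φ : Form (suc n)} → Δ0 φ → Δ0 (∃<' t φ)

data Σ1 : {n : ℕ} → Form n → Set where
  s-Δ0 : ∀ {n} {φ : Form n} → Δ0 φ → Σ1 φ
  s-∃  : ∀ {n} {φ : Form (suc n)} → Σ1 φ → Σ1 (∃' φ)

data Σ1□ : {n : ℕ} → Form n → Set where
  b-Σ1 : ∀ {n} {φ : Form n} → Σ1 φ → Σ1□ φ
  b-□  : ∀ {n} {φ : Form n} → Σ1□ (□ φ)
  b-∧  : ∀ {n} {φ ψ : Form n} → Σ1□ φ → Σ1□ ψ → Σ1□ (φ ∧' ψ)
  b-∨  : ∀ {n} {φ ψ : Form n} → Σ1□ φ → Σ1□ ψ → Σ1□ (φ ∨' ψ)
  b-∃  : ∀ {n} {φ : Form (suc n)} → Σ1□ φ → Σ1□ (∃' φ)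
  b-∀< : ∀ {n} {t : Term n} {φ : Form (suc n)} → Σ1□ φ → Σ1□ (∀<' t φ)

MDP : (Sentence → Set) → Set
MDP T = (φ ψ : Sentence) → T ⊢ □ φ ∨' □ ψ → (T ⊢ φ) ⊎ (T ⊢ ψ)

MEP : (Sentence → Set) → Set
MEP T = (φ : Form 1) → T ⊢ ∃' (□ φ) → ∃ λ k → T ⊢ inst φ (num k)

Σ1□-DP : (Sentence → Set) → Set
Σ1□-DP T = (φ ψ : Sentence) → Σ1□ φ → Σ1□ ψ → T ⊢ φ ∨' ψ → (T ⊢ φ) ⊎ (T ⊢ ψ)

Σ1□-EP : (Sentence → Set) → Set
Σ1□-EP T = (φ : Form 1) → Σ1□ φ → T ⊢ ∃' φ → ∃ λ k → T ⊢ inst φ (num k)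

{-# OPTIONS --safe #-}
-- Every Σ1(□) formula φ satisfies T ⊢ φ → □ φ. For atomic formulas and their negations
-- this is arithmetic in PA (trichotomy turns a ≠ b and a ≰ b into inequalities, which carry
-- an existential witness); ∧, ∨ and ∃ preserve it by K, □ φ → □ □ φ is axiom 4, negations
-- of compound Δ0 formulas are pushed inwards, and a bounded ∀ needs induction on the bound.
-- Hence T ⊢ φ ∨ ψ yields T ⊢ □ φ ∨ □ ψ, and T ⊢ ∃x φ yields T ⊢ ∃x □ φ, to which MDP and
-- MEP apply.
module Submission where

open import Defs
open import Data.Product using (_×_; _,_)
open import Data.Nat using (ℕ; zero; suc)
open import Data.Fin using (Fin; zero; suc)
open import Data.List using (List; []; _∷_)
open import Data.List.Membership.Propositional using (_∈_)
open import Data.List.Relation.Unary.Any using (here; there)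
open import Relation.Binary.PropositionalEquality
  using (_≡_; refl; sym; trans; cong; cong₂) renaming (subst to transport)

Sub : ℕ → ℕ → Set
Sub n m = Fin n → Term m

shift : ∀ {n} → Sub n (suc n)
shift i = var (suc i)

renT≡substT : ∀ {n m} (ρ : Fin n → Fin m) t → renT ρ t ≡ substT (λ i → var (ρ i)) t
renT≡substT ρ (var i) = refl
renT≡substT ρ 𝟎 = refl
renT≡substT ρ (S t) = cong S (renT≡substT ρ t)
renT≡substT ρ (t ⊕ u) = cong₂ _⊕_ (renT≡substT ρ t) (renT≡substT ρ u)
renT≡substT ρ (t ⊗ u) = cong₂ _⊗_ (renT≡substT ρ t) (renT≡substT ρ u)

substT-cong : ∀ {n m} {σ τ : Sub n m} → (∀ i → σ i ≡ τ i) → ∀ t → substT σ t ≡ substT τ t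
substT-cong e (var i) = e i
substT-cong e 𝟎 = refl
substT-cong e (S t) = cong S (substT-cong e t)
substT-cong e (t ⊕ u) = cong₂ _⊕_ (substT-cong e t) (substT-cong e u)
substT-cong e (t ⊗ u) = cong₂ _⊗_ (substT-cong e t) (substT-cong e u)

substT-∘ : ∀ {n m k} (σ : Sub m k) (τ : Sub n m) t →
  substT σ (substT τ t) ≡ substT (λ i → substT σ (τ i)) t
substT-∘ σ τ (var i) = refl
substT-∘ σ τ 𝟎 = refl
substT-∘ σ τ (S t) = cong S (substT-∘ σ τ t)
substT-∘ σ τ (t ⊕ u) = cong₂ _⊕_ (substT-∘ σ τ t) (substT-∘ σ τ u)
substT-∘ σ τ (t ⊗ u) = cong₂ _⊗_ (substT-∘ σ τ t) (substT-∘ σ τ u)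

substT-id : ∀ {n} {σ : Sub n n} → (∀ i → σ i ≡ var i) → ∀ t → substT σ t ≡ t
substT-id e (var i) = e i
substT-id e 𝟎 = refl
substT-id e (S t) = cong S (substT-id e t)
substT-id e (t ⊕ u) = cong₂ _⊕_ (substT-id e t) (substT-id e u)
substT-id e (t ⊗ u) = cong₂ _⊗_ (substT-id e t) (substT-id e u)

substT-wkT : ∀ {n m} (σ : Sub (suc n) m) t → substT σ (wkT t) ≡ substT (λ i → σ (suc i)) t
substT-wkT σ t = trans (cong (substT σ) (renT≡substT suc t)) (substT-∘ σ shift t)

wkT-substT : ∀ {n m} (σ : Sub n m) t → wkT (substT σ t) ≡ substT (λ i → wkT (σ i)) t
wkT-substT σ t = trans (renT≡substT suc (substT σ t))
  (trans (substT-∘ shift σ t) (substT-cong (λ i → sym (renT≡substT suc (σ i))) t))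

substT-single-wkT : ∀ {n} (s : Term n) u → substT (single s) (wkT u) ≡ u
substT-single-wkT s u = trans (substT-wkT (single s) u) (substT-id (λ i → refl) u)

exts-cong : ∀ {n m} {σ τ : Sub n m} → (∀ i → σ i ≡ τ i) → ∀ i → exts σ i ≡ exts τ i
exts-cong e zero = refl
exts-cong e (suc i) = cong wkT (e i)

exts-id : ∀ {n} {σ : Sub n n} → (∀ i → σ i ≡ var i) → ∀ i → exts σ i ≡ var i
exts-id e zero = refl
exts-id e (suc i) = cong wkT (e i)

exts-∘ : ∀ {n m k} (σ : Sub m k) (τ : Sub n m) i →
  substT (exts σ) (exts τ i) ≡ exts (λ j → substT σ (τ j)) i
exts-∘ σ τ zero = refl
exts-∘ σ τ (suc i) = trans (substT-wkT (exts σ) (τ i)) (sym (wkT-substT σ (τ i)))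

subst-cong : ∀ {n m} {σ τ : Sub n m} → (∀ i → σ i ≡ τ i) → ∀ φ → subst σ φ ≡ subst τ φ
subst-cong e (t ≐ u) = cong₂ _≐_ (substT-cong e t) (substT-cong e u)
subst-cong e (t ≼ u) = cong₂ _≼_ (substT-cong e t) (substT-cong e u)
subst-cong e ⊥' = refl
subst-cong e (φ ⇒ ψ) = cong₂ _⇒_ (subst-cong e φ) (subst-cong e ψ)
subst-cong e (φ ∧' ψ) = cong₂ _∧'_ (subst-cong e φ) (subst-cong e ψ)
subst-cong e (φ ∨' ψ) = cong₂ _∨'_ (subst-cong e φ) (subst-cong e ψ)
subst-cong e (∀' φ) = cong ∀' (subst-cong (exts-cong e) φ)
subst-cong e (∃' φ) = cong ∃' (subst-cong (exts-cong e) φ)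
subst-cong e (□ φ) = cong □ (subst-cong e φ)

subst-∘ : ∀ {n m k} (σ : Sub m k) (τ : Sub n m) φ →
  subst σ (subst τ φ) ≡ subst (λ i → substT σ (τ i)) φ
subst-∘ σ τ (t ≐ u) = cong₂ _≐_ (substT-∘ σ τ t) (substT-∘ σ τ u)
subst-∘ σ τ (t ≼ u) = cong₂ _≼_ (substT-∘ σ τ t) (substT-∘ σ τ u)
subst-∘ σ τ ⊥' = refl
subst-∘ σ τ (φ ⇒ ψ) = cong₂ _⇒_ (subst-∘ σ τ φ) (subst-∘ σ τ ψ)
subst-∘ σ τ (φ ∧' ψ) = cong₂ _∧'_ (subst-∘ σ τ φ) (subst-∘ σ τ ψ)
subst-∘ σ τ (φ ∨' ψ) = cong₂ _∨'_ (subst-∘ σ τ φ) (subst-∘ σ τ ψ)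
subst-∘ σ τ (∀' φ) = cong ∀' (trans (subst-∘ (exts σ) (exts τ) φ) (subst-cong (exts-∘ σ τ) φ))
subst-∘ σ τ (∃' φ) = cong ∃' (trans (subst-∘ (exts σ) (exts τ) φ) (subst-cong (exts-∘ σ τ) φ))
subst-∘ σ τ (□ φ) = cong □ (subst-∘ σ τ φ)

subst-id : ∀ {n} {σ : Sub n n} → (∀ i → σ i ≡ var i) → ∀ φ → subst σ φ ≡ φ
subst-id e (t ≐ u) = cong₂ _≐_ (substT-id e t) (substT-id e u)
subst-id e (t ≼ u) = cong₂ _≼_ (substT-id e t) (substT-id e u)
subst-id e ⊥' = refl
subst-id e (φ ⇒ ψ) = cong₂ _⇒_ (subst-id e φ) (subst-id e ψ)
subst-id e (φ ∧' ψ) = cong₂ _∧'_ (subst-id e φ) (subst-id e ψ)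
subst-id e (φ ∨' ψ) = cong₂ _∨'_ (subst-id e φ) (subst-id e ψ)
subst-id e (∀' φ) = cong ∀' (subst-id (exts-id e) φ)
subst-id e (∃' φ) = cong ∃' (subst-id (exts-id e) φ)
subst-id e (□ φ) = cong □ (subst-id e φ)

subst-inst : ∀ {n m} (σ : Sub n m) (φ : Form (suc n)) t →
  subst σ (inst φ t) ≡ inst (subst (exts σ) φ) (substT σ t)
subst-inst σ φ t = trans (subst-∘ σ (single t) φ)
  (trans (subst-cong agree φ) (sym (subst-∘ (single (substT σ t)) (exts σ) φ)))
  where
  agree : ∀ i → substT σ (single t i) ≡ substT (single (substT σ t)) (exts σ i)
  agree zero = refl
  agree (suc i) = sym (substT-single-wkT (substT σ t) (σ i))

subst-exts-wk : ∀ {n m} (σ : Sub n m) (ψ : Form n) → subst (exts σ) (wk ψ) ≡ wk (subst σ ψ)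
subst-exts-wk σ ψ = trans (subst-∘ (exts σ) shift ψ)
  (trans (subst-cong (λ i → renT≡substT suc (σ i)) ψ) (sym (subst-∘ shift σ ψ)))

subst-emb : ∀ {n m} (σ : Sub n m) (φ : Sentence) → subst σ (emb φ) ≡ emb φ
subst-emb σ φ = trans (subst-∘ σ (λ ()) φ) (subst-cong (λ ()) φ)

infixr 5 _∷ₛ_

∅ₛ : ∀ {m} → Sub 0 m
∅ₛ ()

_∷ₛ_ : ∀ {n m} → Term m → Sub n m → Sub (suc n) m
(s ∷ₛ σ) zero = s
(s ∷ₛ σ) (suc i) = σ i

inst-exts : ∀ {n m} (σ : Sub n m) (φ : Form (suc n)) s →
  inst (subst (exts σ) φ) s ≡ subst (s ∷ₛ σ) φ
inst-exts σ φ s = trans (subst-∘ (single s) (exts σ) φ) (subst-cong agree φ)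
  where
  agree : ∀ i → substT (single s) (exts σ i) ≡ (s ∷ₛ σ) i
  agree zero = refl
  agree (suc i) = substT-single-wkT s (σ i)

wk₁ : ∀ {n} → Form (suc n) → Form (suc (suc n))
wk₁ = subst (exts shift)

inst-wk₁ : ∀ {n} (φ : Form (suc n)) → inst (wk₁ φ) (var zero) ≡ φ
inst-wk₁ φ = trans (inst-exts shift φ (var zero)) (subst-id (λ { zero → refl ; (suc i) → refl }) φ)

subst-exts-wk₁ : ∀ {n m} (σ : Sub (suc n) m) (φ : Form (suc n)) →
  subst (exts σ) (wk₁ φ) ≡ subst (exts (λ i → σ (suc i))) φ
subst-exts-wk₁ σ φ = trans (subst-∘ (exts σ) (exts shift) φ) (subst-cong (exts-∘ σ shift) φ)

succₛ : ∀ {n} → Sub (suc n) (suc n)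
succₛ = S (var zero) ∷ₛ shift

subst-exts-single-wk₁ : ∀ {n} (t : Term n) (φ : Form (suc n)) → subst (exts (single t)) (wk₁ φ) ≡ φ
subst-exts-single-wk₁ t φ = trans (subst-exts-wk₁ (single t) φ) (subst-id (exts-id (λ i → refl)) φ)

shift² : ∀ {n} → Sub n (suc (suc n))
shift² i = var (suc (suc i))

inst-exts-shift²-var1 : ∀ {n} (φ : Form (suc n)) → inst (subst (exts shift²) φ) (var (suc zero)) ≡ wk φ
inst-exts-shift²-var1 φ = trans (inst-exts shift² φ _) (subst-cong (λ { zero → refl ; (suc i) → refl }) φ)

inst-exts-shift²-var0 : ∀ {n} (φ : Form (suc n)) → inst (subst (exts shift²) φ) (var zero) ≡ wk₁ φ
inst-exts-shift²-var0 φ = trans (inst-exts shift² φ _) (subst-cong (λ { zero → refl ; (suc i) → refl }) φ)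

module Derivations (T : Sentence → Set) where

  private variable
    n : ℕ
    φ ψ χ : Form n
    Γ Δ : List (Form n)

  cast : φ ≡ ψ → T ⊢ φ → T ⊢ ψ
  cast = transport (T ⊢_)

  LogAx-subst : ∀ {m} (σ : Sub n m) → LogAx φ → T ⊢ subst σ φ
  LogAx-subst σ ax-K = byLog ax-K
  LogAx-subst σ ax-S = byLog ax-S
  LogAx-subst σ ax-∧I = byLog ax-∧I
  LogAx-subst σ ax-∧E₁ = byLog ax-∧E₁
  LogAx-subst σ ax-∧E₂ = byLog ax-∧E₂
  LogAx-subst σ ax-∨I₁ = byLog ax-∨I₁
  LogAx-subst σ ax-∨I₂ = byLog ax-∨I₂
  LogAx-subst σ ax-∨E = byLog ax-∨E
  LogAx-subst σ ax-⊥E = byLog ax-⊥E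
  LogAx-subst σ ax-DN = byLog ax-DN
  LogAx-subst σ (ax-∀E {φ = φ} {t}) =
    cast (cong (∀' (subst (exts σ) φ) ⇒_) (sym (subst-inst σ φ t))) (byLog ax-∀E)
  LogAx-subst σ (ax-∀I {ψ = ψ} {φ}) =
    cast (cong (λ χ → ∀' (χ ⇒ subst (exts σ) φ) ⇒ subst σ ψ ⇒ ∀' (subst (exts σ) φ))
               (sym (subst-exts-wk σ ψ))) (byLog ax-∀I)
  LogAx-subst σ (ax-∃I {φ = φ} {t}) =
    cast (cong (_⇒ ∃' (subst (exts σ) φ)) (sym (subst-inst σ φ t))) (byLog ax-∃I)
  LogAx-subst σ (ax-∃E {φ = φ} {ψ}) =
    cast (cong (λ χ → ∀' (subst (exts σ) φ ⇒ χ) ⇒ ∃' (subst (exts σ) φ) ⇒ subst σ ψ)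
               (sym (subst-exts-wk σ ψ))) (byLog ax-∃E)
  LogAx-subst σ ax-refl = byLog ax-refl
  LogAx-subst σ (ax-Leib {φ = φ} {t} {u}) =
    cast (cong₂ (λ χ χ' → substT σ t ≐ substT σ u ⇒ χ ⇒ χ')
                (sym (subst-inst σ φ t)) (sym (subst-inst σ φ u))) (byLog ax-Leib)

  ⊢-subst : ∀ {m} → T ⊢ φ → (σ : Sub n m) → T ⊢ subst σ φ
  ⊢-subst (byLog ax) σ = LogAx-subst σ ax
  ⊢-subst (byAx {φ = φ} ax) σ = cast (sym (subst-emb σ φ)) (byAx ax)
  ⊢-subst (mp p q) σ = mp (⊢-subst p σ) (⊢-subst q σ)
  ⊢-subst (gen p) σ = gen (⊢-subst p (exts σ))
  ⊢-subst (nec p) σ = nec (⊢-subst p σ)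

  ⊢-∀-elim-var0 : {φ : Form (suc n)} → T ⊢ ∀' φ → T ⊢ φ
  ⊢-∀-elim-var0 {φ = φ} p = cast (inst-wk₁ φ) (mp (byLog ax-∀E) (⊢-subst p shift))

  ⊢-unclose : ∀ {n} (φ : Form n) → T ⊢ close φ → T ⊢ φ
  ⊢-unclose {zero} φ p = p
  ⊢-unclose {suc n} φ p = ⊢-∀-elim-var0 (⊢-unclose (∀' φ) p)

  ⊢-emb : {φ : Sentence} → T ⊢ φ → T ⊢ emb {n} φ
  ⊢-emb {φ = φ} p = cast (subst-cong (λ ()) φ) (⊢-subst p (λ ()))

  ⊢-id : T ⊢ φ ⇒ φ
  ⊢-id {φ = φ} = mp (mp (byLog ax-S) (byLog ax-K)) (byLog (ax-K {ψ = φ}))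

  infix 2 _⊩_

  data _⊩_ {n} (Γ : List (Form n)) : Form n → Set where
    hyp : φ ∈ Γ → Γ ⊩ φ
    thm : T ⊢ φ → Γ ⊩ φ
    app : Γ ⊩ φ ⇒ ψ → Γ ⊩ φ → Γ ⊩ ψ

  ⊩-cast : φ ≡ ψ → Γ ⊩ φ → Γ ⊩ ψ
  ⊩-cast = transport (_ ⊩_)

  ⇒-intro : φ ∷ Γ ⊩ ψ → Γ ⊩ φ ⇒ ψ
  ⇒-intro (hyp (here refl)) = thm ⊢-id
  ⇒-intro (hyp (there x)) = app (thm (byLog ax-K)) (hyp x)
  ⇒-intro (thm p) = app (thm (byLog ax-K)) (thm p)
  ⇒-intro (app p q) = app (app (thm (byLog ax-S)) (⇒-intro p)) (⇒-intro q)

  ⊩⇒⊢ : [] ⊩ φ → T ⊢ φ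
  ⊩⇒⊢ (thm p) = p
  ⊩⇒⊢ (app p q) = mp (⊩⇒⊢ p) (⊩⇒⊢ q)

  ⊩-cut : (∀ {φ} → φ ∈ Γ → Δ ⊩ φ) → Γ ⊩ ψ → Δ ⊩ ψ
  ⊩-cut f (hyp x) = f x
  ⊩-cut f (thm p) = thm p
  ⊩-cut f (app p q) = app (⊩-cut f p) (⊩-cut f q)

  ⊩-weaken : Γ ⊩ ψ → φ ∷ Γ ⊩ ψ
  ⊩-weaken = ⊩-cut (λ x → hyp (there x))

  ⊩-weaken₁ : φ ∷ Γ ⊩ χ → φ ∷ ψ ∷ Γ ⊩ χ
  ⊩-weaken₁ = ⊩-cut (λ { (here refl) → hyp (here refl) ; (there x) → hyp (there (there x)) })

  #0 : φ ∷ Γ ⊩ φ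
  #0 = hyp (here refl)

  #1 : ψ ∷ φ ∷ Γ ⊩ φ
  #1 = hyp (there (here refl))

  #2 : χ ∷ ψ ∷ φ ∷ Γ ⊩ φ
  #2 = hyp (there (there (here refl)))

  ∧-intro : Γ ⊩ φ → Γ ⊩ ψ → Γ ⊩ φ ∧' ψ
  ∧-intro p q = app (app (thm (byLog ax-∧I)) p) q

  ∧-elim₁ : Γ ⊩ φ ∧' ψ → Γ ⊩ φ
  ∧-elim₁ = app (thm (byLog ax-∧E₁))

  ∧-elim₂ : Γ ⊩ φ ∧' ψ → Γ ⊩ ψ
  ∧-elim₂ = app (thm (byLog ax-∧E₂))

  ∨-intro₁ : Γ ⊩ φ → Γ ⊩ φ ∨' ψ
  ∨-intro₁ = app (thm (byLog ax-∨I₁))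

  ∨-intro₂ : Γ ⊩ ψ → Γ ⊩ φ ∨' ψ
  ∨-intro₂ = app (thm (byLog ax-∨I₂))

  ∨-elim : Γ ⊩ φ ∨' ψ → φ ∷ Γ ⊩ χ → ψ ∷ Γ ⊩ χ → Γ ⊩ χ
  ∨-elim p q r = app (app (app (thm (byLog ax-∨E)) (⇒-intro q)) (⇒-intro r)) p

  ex-falso : Γ ⊩ ⊥' → Γ ⊩ φ
  ex-falso = app (thm (byLog ax-⊥E))

  ¬' : Form n → Form n
  ¬' φ = φ ⇒ ⊥'

  by-contradiction : ¬' φ ∷ Γ ⊩ ⊥' → Γ ⊩ φ
  by-contradiction p = app (thm (byLog ax-DN)) (⇒-intro p)

  excluded-middle : Γ ⊩ φ ∨' ¬' φ
  excluded-middle = by-contradiction (app #0 (∨-intro₂ (⇒-intro (app #1 (∨-intro₁ #0)))))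

  ⋀ : List (Form n) → Form n
  ⋀ [] = ⊥' ⇒ ⊥'
  ⋀ (φ ∷ Γ) = φ ∧' ⋀ Γ

  ⊩-⋀ : (Γ : List (Form n)) → Γ ⊩ ⋀ Γ
  ⊩-⋀ [] = thm ⊢-id
  ⊩-⋀ (φ ∷ Γ) = ∧-intro #0 (⊩-weaken (⊩-⋀ Γ))

  ⋀-elim : Δ ⊩ ⋀ Γ → φ ∈ Γ → Δ ⊩ φ
  ⋀-elim p (here refl) = ∧-elim₁ p
  ⋀-elim p (there x) = ⋀-elim (∧-elim₂ p) x

  wkᶜ : List (Form n) → List (Form (suc n))
  wkᶜ [] = []
  wkᶜ (φ ∷ Γ) = wk φ ∷ wkᶜ Γ

  ⋀-wkᶜ : (Γ : List (Form n)) → ⋀ (wkᶜ Γ) ≡ wk (⋀ Γ)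
  ⋀-wkᶜ [] = refl
  ⋀-wkᶜ (φ ∷ Γ) = cong (wk φ ∧'_) (⋀-wkᶜ Γ)

  -- The Hilbert rules for ∀ and ∃ need a side formula free of the bound variable;
  -- the conjunction of the context serves as that formula.
  ∀-intro : {φ : Form (suc n)} → wkᶜ Γ ⊩ φ → Γ ⊩ ∀' φ
  ∀-intro {Γ = Γ} {φ} p = app (thm (mp (byLog ax-∀I) (gen (⊩⇒⊢ (⊩-cast (cong (_⇒ φ) (⋀-wkᶜ Γ))
    (⇒-intro (⊩-cut (⋀-elim #0) p))))))) (⊩-⋀ Γ)

  ∀-elim : {φ : Form (suc n)} (t : Term n) → Γ ⊩ ∀' φ → Γ ⊩ inst φ t
  ∀-elim t = app (thm (byLog ax-∀E))

  ∃-intro : {φ : Form (suc n)} (t : Term n) → Γ ⊩ inst φ t → Γ ⊩ ∃' φ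
  ∃-intro t = app (thm (byLog ax-∃I))

  ∃-elim : {φ : Form (suc n)} → Γ ⊩ ∃' φ → φ ∷ wkᶜ Γ ⊩ wk ψ → Γ ⊩ ψ
  ∃-elim {Γ = Γ} {φ = φ} p q =
    app (app (thm (mp (byLog ax-∃E) (gen (⊩⇒⊢ (⇒-intro (⇒-intro (⊩-cut from-⋀ q))))))) p) (⊩-⋀ Γ)
    where
    from-⋀ : ∀ {χ} → χ ∈ φ ∷ wkᶜ Γ → wk (⋀ Γ) ∷ φ ∷ [] ⊩ χ
    from-⋀ (here refl) = #1
    from-⋀ (there x) = ⋀-elim (⊩-cast (sym (⋀-wkᶜ Γ)) #0) x

  ≐-elim : ∀ (χ : Form (suc n)) {t u} → Γ ⊩ t ≐ u → Γ ⊩ inst χ t → Γ ⊩ inst χ u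
  ≐-elim χ e p = app (app (thm (byLog ax-Leib)) e) p

  ≐-refl : ∀ {t : Term n} → Γ ⊩ t ≐ t
  ≐-refl = thm (byLog ax-refl)

  ∀-elim-var0 : {Γ : List (Form (suc n))} {φ : Form (suc n)} → Γ ⊩ wk (∀' φ) → Γ ⊩ φ
  ∀-elim-var0 {φ = φ} p = ⊩-cast (inst-wk₁ φ) (∀-elim (var zero) p)

  ∃-intro-var0 : {Γ : List (Form (suc n))} {φ : Form (suc n)} → Γ ⊩ φ → Γ ⊩ wk (∃' φ)
  ∃-intro-var0 {φ = φ} p = ∃-intro (var zero) (⊩-cast (sym (inst-wk₁ φ)) p)

module PAK4 {T : Sentence → Set} (ext : ExtendsPAK4 T) where
  open Derivations T public

  private variable
    n : ℕ
    φ ψ : Form n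
    Γ : List (Form n)
    a b c : Term n

  ⊢-PAK4 : {φ : Sentence} → PAK4Ax φ → T ⊢ emb {n} φ
  ⊢-PAK4 {φ = φ} ax = ⊢-emb (ext φ ax)

  ⊢-K : T ⊢ □ (φ ⇒ ψ) ⇒ □ φ ⇒ □ ψ
  ⊢-K {φ = φ} {ψ} = ⊢-unclose (□ (φ ⇒ ψ) ⇒ □ φ ⇒ □ ψ) (ext _ (k4-K {φ = φ} {ψ = ψ}))

  ⊢-4 : T ⊢ □ φ ⇒ □ (□ φ)
  ⊢-4 {φ = φ} = ⊢-unclose (□ φ ⇒ □ (□ φ)) (ext _ (k4-4 {φ = φ}))

  ⊢-induction : (φ : Form (suc n)) → T ⊢ inst φ 𝟎 → T ⊢ φ ⇒ subst succₛ φ → T ⊢ ∀' φ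
  ⊢-induction φ base step =
    mp (⊢-unclose (induction φ) (ext _ (pa-ind {φ = φ})))
       (mp (mp (byLog ax-∧I) base)
           (gen (cast (cong (φ ⇒_) (subst-cong (λ { zero → refl ; (suc i) → refl }) φ)) step)))

  □-intro : [] ⊩ φ → Γ ⊩ □ φ
  □-intro p = thm (nec (⊩⇒⊢ p))

  □-app : Γ ⊩ □ (φ ⇒ ψ) → Γ ⊩ □ φ → Γ ⊩ □ ψ
  □-app p q = app (app (thm ⊢-K) p) q

  □-map : [] ⊩ φ ⇒ ψ → Γ ⊩ □ φ → Γ ⊩ □ ψ
  □-map p = □-app (□-intro p)

  □-∧ : Γ ⊩ □ φ → Γ ⊩ □ ψ → Γ ⊩ □ (φ ∧' ψ)
  □-∧ p q = □-app (□-app (□-intro (thm (byLog ax-∧I))) p) q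

  infix 2 ⊢[_]_

  ⊢[_]_ : (n : ℕ) → Form n → Set
  ⊢[ n ] φ = T ⊢ φ

  v0 : Term (suc n)
  v0 = var zero

  v1 : Term (suc (suc n))
  v1 = var (suc zero)

  v2 : Term (suc (suc (suc n)))
  v2 = var (suc (suc zero))

  v3 : Term (suc (suc (suc (suc n))))
  v3 = var (suc (suc (suc zero)))

  -- Facts about terms are proved for variables and then instantiated with ⊢-subst, where
  -- substitution computes; for arbitrary terms every ≐-elim would need a substitution lemma.
  ≐-sym : Γ ⊩ a ≐ b → Γ ⊩ b ≐ a
  ≐-sym {a = a} {b = b} = app (thm (⊢-subst sym-var (a ∷ₛ b ∷ₛ ∅ₛ)))
    where
    sym-var : ⊢[ 2 ] v0 ≐ v1 ⇒ v1 ≐ v0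
    sym-var = ⊩⇒⊢ (⇒-intro (≐-elim (var zero ≐ var (suc zero)) #0 ≐-refl))

  ≐-trans : Γ ⊩ a ≐ b → Γ ⊩ b ≐ c → Γ ⊩ a ≐ c
  ≐-trans {a = a} {b = b} {c = c} p q = app (app (thm (⊢-subst trans-var (a ∷ₛ b ∷ₛ c ∷ₛ ∅ₛ))) p) q
    where
    trans-var : ⊢[ 3 ] v0 ≐ v1 ⇒ v1 ≐ v2 ⇒ v0 ≐ v2
    trans-var = ⊩⇒⊢ (⇒-intro (⇒-intro (≐-elim (var (suc zero) ≐ var zero) #0 #1)))

  S-cong : Γ ⊩ a ≐ b → Γ ⊩ S a ≐ S b
  S-cong {a = a} {b = b} = app (thm (⊢-subst S-cong-var (a ∷ₛ b ∷ₛ ∅ₛ)))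
    where
    S-cong-var : ⊢[ 2 ] v0 ≐ v1 ⇒ S v0 ≐ S v1
    S-cong-var = ⊩⇒⊢ (⇒-intro (≐-elim (S (var (suc zero)) ≐ S (var zero)) #0 ≐-refl))

  +-congˡ : ∀ c → Γ ⊩ a ≐ b → Γ ⊩ c ⊕ a ≐ c ⊕ b
  +-congˡ {a = a} {b = b} c = app (thm (⊢-subst +-congˡ-var (a ∷ₛ b ∷ₛ c ∷ₛ ∅ₛ)))
    where
    +-congˡ-var : ⊢[ 3 ] v0 ≐ v1 ⇒ v2 ⊕ v0 ≐ v2 ⊕ v1
    +-congˡ-var = ⊩⇒⊢ (⇒-intro (≐-elim (v3 ⊕ v1 ≐ v3 ⊕ v0) #0 ≐-refl))

  +-congʳ : ∀ c → Γ ⊩ a ≐ b → Γ ⊩ a ⊕ c ≐ b ⊕ c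
  +-congʳ {a = a} {b = b} c = app (thm (⊢-subst +-congʳ-var (a ∷ₛ b ∷ₛ c ∷ₛ ∅ₛ)))
    where
    +-congʳ-var : ⊢[ 3 ] v0 ≐ v1 ⇒ v0 ⊕ v2 ≐ v1 ⊕ v2
    +-congʳ-var = ⊩⇒⊢ (⇒-intro (≐-elim (v1 ⊕ v3 ≐ v0 ⊕ v3) #0 ≐-refl))

  +-identityʳ : ∀ a → Γ ⊩ a ⊕ 𝟎 ≐ a
  +-identityʳ a = ∀-elim a (thm (⊢-PAK4 pa-+0))

  +-suc : ∀ a b → Γ ⊩ a ⊕ S b ≐ S (a ⊕ b)
  +-suc a b = thm (⊢-subst +-suc-var (b ∷ₛ a ∷ₛ ∅ₛ))
    where
    +-suc-var : ⊢[ 2 ] v1 ⊕ S v0 ≐ S (v1 ⊕ v0)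
    +-suc-var = ⊩⇒⊢ (∀-elim v0 (∀-elim v1 (thm (⊢-PAK4 pa-+S))))

  S≢0 : Γ ⊩ S a ≐ 𝟎 → Γ ⊩ ⊥'
  S≢0 {a = a} = app (∀-elim a (thm (⊢-PAK4 pa-S≠0)))

  S-injective : Γ ⊩ S a ≐ S b → Γ ⊩ a ≐ b
  S-injective {a = a} {b = b} = app (thm (⊢-subst S-injective-var (b ∷ₛ a ∷ₛ ∅ₛ)))
    where
    S-injective-var : ⊢[ 2 ] S v1 ≐ S v0 ⇒ v1 ≐ v0
    S-injective-var = ⊩⇒⊢ (∀-elim v0 (∀-elim v1 (thm (⊢-PAK4 pa-Sinj))))

  ≼-def : ⊢[ 2 ] (v1 ≼ v0 ⇒ ∃' (v2 ⊕ v0 ≐ v1)) ∧' (∃' (v2 ⊕ v0 ≐ v1) ⇒ v1 ≼ v0)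
  ≼-def = ⊩⇒⊢ (∀-elim v0 (∀-elim v1 (thm (⊢-PAK4 pa-≤))))

  ≼-intro : ∀ c → Γ ⊩ a ⊕ c ≐ b → Γ ⊩ a ≼ b
  ≼-intro {a = a} {b = b} c p = app (∧-elim₂ (thm (⊢-subst ≼-def (b ∷ₛ a ∷ₛ ∅ₛ))))
    (∃-intro c (⊩-cast (cong₂ (λ a' b' → a' ⊕ c ≐ b')
      (sym (substT-single-wkT c a)) (sym (substT-single-wkT c b))) p))

  ≼-elim : Γ ⊩ a ≼ b → (wkT a ⊕ v0 ≐ wkT b) ∷ wkᶜ Γ ⊩ wk φ → Γ ⊩ φ
  ≼-elim {a = a} {b = b} p = ∃-elim (app (∧-elim₁ (thm (⊢-subst ≼-def (b ∷ₛ a ∷ₛ ∅ₛ)))) p)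

  zero-or-suc : ∀ a → a ≐ 𝟎 ∷ Γ ⊩ φ → (wkT a ≐ S v0) ∷ wkᶜ Γ ⊩ wk φ → Γ ⊩ φ
  zero-or-suc a p q = ∨-elim (∀-elim a (thm zero-or-suc-∀)) p (∃-elim #0 (⊩-weaken₁ q))
    where
    zero-or-suc-∀ : T ⊢ ∀' (v0 ≐ 𝟎 ∨' ∃' (v1 ≐ S v0))
    zero-or-suc-∀ = ⊢-induction (v0 ≐ 𝟎 ∨' ∃' (v1 ≐ S v0))
      (⊩⇒⊢ (∨-intro₁ ≐-refl)) (⊩⇒⊢ (⇒-intro (∨-intro₂ (∃-intro v0 ≐-refl))))

  +-identityˡ : ∀ a → Γ ⊩ 𝟎 ⊕ a ≐ a
  +-identityˡ a = ∀-elim a (thm +-identityˡ-∀)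
    where
    +-identityˡ-∀ : T ⊢ ∀' (𝟎 ⊕ v0 ≐ v0)
    +-identityˡ-∀ = ⊢-induction (𝟎 ⊕ v0 ≐ v0)
      (⊩⇒⊢ (+-identityʳ 𝟎)) (⊩⇒⊢ (⇒-intro (≐-trans (+-suc 𝟎 v0) (S-cong #0))))

  +-sucˡ : ∀ a b → Γ ⊩ S a ⊕ b ≐ S (a ⊕ b)
  +-sucˡ a b = thm (⊢-subst (⊩⇒⊢ (∀-elim v1 (thm +-sucˡ-∀))) (a ∷ₛ b ∷ₛ ∅ₛ))
    where
    +-sucˡ-∀ : ⊢[ 2 ] ∀' (S v1 ⊕ v0 ≐ S (v1 ⊕ v0))
    +-sucˡ-∀ = ⊢-induction (S v1 ⊕ v0 ≐ S (v1 ⊕ v0))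
      (⊩⇒⊢ (≐-trans (+-identityʳ (S v0)) (S-cong (≐-sym (+-identityʳ v0)))))
      (⊩⇒⊢ (⇒-intro (≐-trans (+-suc (S v1) v0)
        (≐-trans (S-cong #0) (S-cong (≐-sym (+-suc v1 v0)))))))

  +-assoc : ∀ a b c → Γ ⊩ (a ⊕ b) ⊕ c ≐ a ⊕ (b ⊕ c)
  +-assoc a b c = thm (⊢-subst (⊩⇒⊢ (∀-elim v2 (thm +-assoc-∀))) (b ∷ₛ a ∷ₛ c ∷ₛ ∅ₛ))
    where
    +-assoc-∀ : ⊢[ 3 ] ∀' ((v2 ⊕ v1) ⊕ v0 ≐ v2 ⊕ (v1 ⊕ v0))
    +-assoc-∀ = ⊢-induction ((v2 ⊕ v1) ⊕ v0 ≐ v2 ⊕ (v1 ⊕ v0))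
      (⊩⇒⊢ (≐-trans (+-identityʳ (v1 ⊕ v0)) (+-congˡ v1 (≐-sym (+-identityʳ v0)))))
      (⊩⇒⊢ (⇒-intro (≐-trans (+-suc (v2 ⊕ v1) v0) (≐-trans (S-cong #0)
        (≐-trans (≐-sym (+-suc v2 (v1 ⊕ v0))) (+-congˡ v2 (≐-sym (+-suc v1 v0))))))))

  m+1+n≢m : Γ ⊩ a ⊕ S b ≐ a → Γ ⊩ ⊥'
  m+1+n≢m {a = a} {b = b} = app (thm (⊢-subst (⊩⇒⊢ (∀-elim v1 (thm m+1+n≢m-∀))) (b ∷ₛ a ∷ₛ ∅ₛ)))
    where
    m+1+n≢m-∀ : ⊢[ 2 ] ∀' (¬' (v0 ⊕ S v1 ≐ v0))
    m+1+n≢m-∀ = ⊢-induction (¬' (v0 ⊕ S v1 ≐ v0))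
      (⊩⇒⊢ (⇒-intro (S≢0 (≐-trans (≐-sym (+-identityˡ (S v0))) #0))))
      (⊩⇒⊢ (⇒-intro (⇒-intro (app #1 (S-injective (≐-trans (≐-sym (+-sucˡ v0 (S v1))) #0))))))

  ≼-refl : ∀ a → Γ ⊩ a ≼ a
  ≼-refl a = ≼-intro 𝟎 (+-identityʳ a)

  m≤n⇒m<n∨m≡n : Γ ⊩ a ≼ b → Γ ⊩ S a ≼ b ∨' a ≐ b
  m≤n⇒m<n∨m≡n {a = a} {b = b} = app (thm (⊢-subst split-var (a ∷ₛ b ∷ₛ ∅ₛ)))
    where
    split-var : ⊢[ 2 ] v0 ≼ v1 ⇒ S v0 ≼ v1 ∨' v0 ≐ v1
    split-var = ⊩⇒⊢ (⇒-intro (≼-elim #0 (zero-or-suc v0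
      (∨-intro₂ (≐-trans (≐-sym (+-identityʳ v1)) (≐-trans (+-congˡ v1 (≐-sym #0)) #1)))
      (∨-intro₁ (≼-intro v0 (≐-trans (+-sucˡ v2 v0)
        (≐-trans (≐-sym (+-suc v2 v0)) (≐-trans (+-congˡ v2 (≐-sym #0)) #1))))))))

  m≤n⇒m≤1+n : Γ ⊩ a ≼ b → Γ ⊩ a ≼ S b
  m≤n⇒m≤1+n {a = a} {b = b} = app (thm (⊢-subst step-var (a ∷ₛ b ∷ₛ ∅ₛ)))
    where
    step-var : ⊢[ 2 ] v0 ≼ v1 ⇒ v0 ≼ S v1
    step-var = ⊩⇒⊢ (⇒-intro (≼-elim #0 (≼-intro (S v0) (≐-trans (+-suc v1 v0) (S-cong #0)))))

  s≤s⁻¹ : Γ ⊩ S a ≼ S b → Γ ⊩ a ≼ b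
  s≤s⁻¹ {a = a} {b = b} = app (thm (⊢-subst pred-var (a ∷ₛ b ∷ₛ ∅ₛ)))
    where
    pred-var : ⊢[ 2 ] S v0 ≼ S v1 ⇒ v0 ≼ v1
    pred-var = ⊩⇒⊢ (⇒-intro (≼-elim #0 (≼-intro v0 (S-injective (≐-trans (≐-sym (+-sucˡ v1 v0)) #0)))))

  n≮0 : Γ ⊩ S a ≼ 𝟎 → Γ ⊩ ⊥'
  n≮0 {a = a} = app (thm (⊢-subst n≮0-var (a ∷ₛ ∅ₛ)))
    where
    n≮0-var : ⊢[ 1 ] ¬' (S v0 ≼ 𝟎)
    n≮0-var = ⊩⇒⊢ (⇒-intro (≼-elim #0 (S≢0 (≐-trans (≐-sym (+-sucˡ v1 v0)) #0))))

  <⇒≱ : Γ ⊩ S b ≼ a → Γ ⊩ a ≼ b → Γ ⊩ ⊥'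
  <⇒≱ {b = b} {a = a} p q = app (app (thm (⊢-subst <⇒≱-var (a ∷ₛ b ∷ₛ ∅ₛ))) p) q
    where
    <⇒≱-var : ⊢[ 2 ] S v1 ≼ v0 ⇒ ¬' (v0 ≼ v1)
    <⇒≱-var = ⊩⇒⊢ (⇒-intro (⇒-intro (≼-elim #1 (≼-elim #1 (m+1+n≢m
      (≐-trans (+-suc v3 (v1 ⊕ v0)) (≐-trans (≐-sym (+-sucˡ v3 (v1 ⊕ v0)))
        (≐-trans (≐-sym (+-assoc (S v3) v1 v0)) (≐-trans (+-congʳ v0 #1) #0)))))))))

  ≼-total : ∀ a b → Γ ⊩ a ≼ b ∨' S b ≼ a
  ≼-total a b = thm (⊢-subst (⊩⇒⊢ (∀-elim v1 (thm total-∀))) (b ∷ₛ a ∷ₛ ∅ₛ))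
    where
    total-∀ : ⊢[ 2 ] ∀' (v0 ≼ v1 ∨' S v1 ≼ v0)
    total-∀ = ⊢-induction (v0 ≼ v1 ∨' S v1 ≼ v0)
      (⊩⇒⊢ (∨-intro₁ (≼-intro v0 (+-identityˡ v0))))
      (⊩⇒⊢ (⇒-intro (∨-elim #0
        (∨-elim (m≤n⇒m<n∨m≡n #0)
          (∨-intro₁ #0)
          (∨-intro₂ (≼-intro 𝟎 (≐-trans (+-identityʳ (S v1)) (S-cong (≐-sym #0))))))
        (∨-intro₂ (m≤n⇒m≤1+n #0)))))

  □-complete : Form n → Set
  □-complete φ = T ⊢ φ ⇒ □ φ

  □-complete-⇔ : T ⊢ φ ⇒ ψ → T ⊢ ψ ⇒ φ → □-complete φ → □-complete ψ
  □-complete-⇔ to from c = ⊩⇒⊢ (⇒-intro (□-map (thm to) (app (thm c) (app (thm from) #0))))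

  ⊢⇒□-complete : T ⊢ φ → □-complete φ
  ⊢⇒□-complete p = ⊩⇒⊢ (⇒-intro (□-intro (thm p)))

  ⊥-□-complete : □-complete (⊥' {n})
  ⊥-□-complete = ⊩⇒⊢ (⇒-intro (ex-falso #0))

  ∧-□-complete : □-complete φ → □-complete ψ → □-complete (φ ∧' ψ)
  ∧-□-complete c d = ⊩⇒⊢ (⇒-intro (□-∧ (app (thm c) (∧-elim₁ #0)) (app (thm d) (∧-elim₂ #0))))

  ∨-□-complete : □-complete φ → □-complete ψ → □-complete (φ ∨' ψ)
  ∨-□-complete c d = ⊩⇒⊢ (⇒-intro (∨-elim #0
    (□-map (⇒-intro (∨-intro₁ #0)) (app (thm c) #0))
    (□-map (⇒-intro (∨-intro₂ #0)) (app (thm d) #0))))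

  ∃-□-complete : {φ : Form (suc n)} → □-complete φ → □-complete (∃' φ)
  ∃-□-complete c = ⊩⇒⊢ (⇒-intro (∃-elim #0 (□-map (⇒-intro (∃-intro-var0 #0)) (app (thm c) #0))))

  ≐-□-complete : ∀ (a b : Term n) → □-complete (a ≐ b)
  ≐-□-complete a b = ⊢-subst ≐-var (a ∷ₛ b ∷ₛ ∅ₛ)
    where
    ≐-var : ⊢[ 2 ] v0 ≐ v1 ⇒ □ (v0 ≐ v1)
    ≐-var = ⊩⇒⊢ (⇒-intro (≐-elim (□ (var (suc zero) ≐ var zero)) #0 (□-intro ≐-refl)))

  ≼-□-complete : ∀ (a b : Term n) → □-complete (a ≼ b)
  ≼-□-complete a b = ⊢-subst ≼-var (a ∷ₛ b ∷ₛ ∅ₛ)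
    where
    ≼-var : ⊢[ 2 ] v0 ≼ v1 ⇒ □ (v0 ≼ v1)
    ≼-var = ⊩⇒⊢ (⇒-intro (≼-elim #0
      (□-map (⇒-intro (≼-intro v0 #0)) (app (thm (≐-□-complete (v1 ⊕ v0) v2)) #0))))

  ≢-□-complete : ∀ (a b : Term n) → □-complete (¬' (a ≐ b))
  ≢-□-complete a b = ⊢-subst ≢-var (a ∷ₛ b ∷ₛ ∅ₛ)
    where
    ≢-var : ⊢[ 2 ] ¬' (v0 ≐ v1) ⇒ □ (¬' (v0 ≐ v1))
    ≢-var = ⊩⇒⊢ (⇒-intro (∨-elim (≼-total v0 v1)
      (∨-elim (m≤n⇒m<n∨m≡n #0)
        (□-map (⇒-intro (⇒-intro (<⇒≱ (≐-elim (S (var zero) ≼ var (suc (suc zero))) #0 #1) (≼-refl v1))))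
               (app (thm (≼-□-complete (S v0) v1)) #0))
        (ex-falso (app #2 #0)))
      (□-map (⇒-intro (⇒-intro (<⇒≱ (≐-elim (S (var (suc (suc zero))) ≼ var zero) #0 #1) (≼-refl v1))))
             (app (thm (≼-□-complete (S v1) v0)) #0))))

  ≰-□-complete : ∀ (a b : Term n) → □-complete (¬' (a ≼ b))
  ≰-□-complete a b = ⊢-subst ≰-var (a ∷ₛ b ∷ₛ ∅ₛ)
    where
    ≰-var : ⊢[ 2 ] ¬' (v0 ≼ v1) ⇒ □ (¬' (v0 ≼ v1))
    ≰-var = ⊩⇒⊢ (⇒-intro (∨-elim (≼-total v0 v1)
      (ex-falso (app #1 #0))
      (□-map (⇒-intro (⇒-intro (<⇒≱ #1 #0))) (app (thm (≼-□-complete (S v1) v0)) #0))))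

  ⇒-as-¬∨ : T ⊢ (φ ⇒ ψ) ⇒ ¬' φ ∨' ψ
  ⇒-as-¬∨ = ⊩⇒⊢ (⇒-intro (∨-elim excluded-middle (∨-intro₂ (app #1 #0)) (∨-intro₁ #0)))

  ¬∨-as-⇒ : T ⊢ ¬' φ ∨' ψ ⇒ (φ ⇒ ψ)
  ¬∨-as-⇒ = ⊩⇒⊢ (⇒-intro (⇒-intro (∨-elim #1 (ex-falso (app #0 #1)) #0)))

  ¬⇒-as-∧¬ : T ⊢ ¬' (φ ⇒ ψ) ⇒ φ ∧' ¬' ψ
  ¬⇒-as-∧¬ = ⊩⇒⊢ (⇒-intro (∧-intro
    (by-contradiction (app #1 (⇒-intro (ex-falso (app #1 #0)))))
    (⇒-intro (app #1 (⇒-intro #1)))))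

  ∧¬-as-¬⇒ : T ⊢ φ ∧' ¬' ψ ⇒ ¬' (φ ⇒ ψ)
  ∧¬-as-¬⇒ = ⊩⇒⊢ (⇒-intro (⇒-intro (app (∧-elim₂ #1) (app #0 (∧-elim₁ #1)))))

  ¬∧-as-¬∨¬ : T ⊢ ¬' (φ ∧' ψ) ⇒ ¬' φ ∨' ¬' ψ
  ¬∧-as-¬∨¬ = ⊩⇒⊢ (⇒-intro (∨-elim excluded-middle
    (∨-intro₂ (⇒-intro (app #2 (∧-intro #1 #0))))
    (∨-intro₁ #0)))

  ¬∨¬-as-¬∧ : T ⊢ ¬' φ ∨' ¬' ψ ⇒ ¬' (φ ∧' ψ)
  ¬∨¬-as-¬∧ = ⊩⇒⊢ (⇒-intro (⇒-intro (∨-elim #1 (app #0 (∧-elim₁ #1)) (app #0 (∧-elim₂ #1)))))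

  ¬∨-as-¬∧¬ : T ⊢ ¬' (φ ∨' ψ) ⇒ ¬' φ ∧' ¬' ψ
  ¬∨-as-¬∧¬ = ⊩⇒⊢ (⇒-intro (∧-intro (⇒-intro (app #1 (∨-intro₁ #0))) (⇒-intro (app #1 (∨-intro₂ #0)))))

  ¬∧¬-as-¬∨ : T ⊢ ¬' φ ∧' ¬' ψ ⇒ ¬' (φ ∨' ψ)
  ¬∧¬-as-¬∨ = ⊩⇒⊢ (⇒-intro (⇒-intro (∨-elim #0 (app (∧-elim₁ #2) #0) (app (∧-elim₂ #2) #0))))

  ¬∀<-as-∃<¬ : (t : Term n) {φ : Form (suc n)} → T ⊢ ¬' (∀<' t φ) ⇒ ∃<' t (¬' φ)
  ¬∀<-as-∃<¬ t = ⊩⇒⊢ (⇒-intro (by-contradiction (app #1 (∀-intro (⇒-intro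
    (by-contradiction (app #2 (∃-intro-var0 (∧-intro #1 #0)))))))))

  ∃<¬-as-¬∀< : (t : Term n) {φ : Form (suc n)} → T ⊢ ∃<' t (¬' φ) ⇒ ¬' (∀<' t φ)
  ∃<¬-as-¬∀< t = ⊩⇒⊢ (⇒-intro (⇒-intro (∃-elim #1 (app (∧-elim₂ #0) (app (∀-elim-var0 #1) (∧-elim₁ #0))))))

  ¬∃<-as-∀<¬ : (t : Term n) {φ : Form (suc n)} → T ⊢ ¬' (∃<' t φ) ⇒ ∀<' t (¬' φ)
  ¬∃<-as-∀<¬ t = ⊩⇒⊢ (⇒-intro (∀-intro (⇒-intro (⇒-intro (app #2 (∃-intro-var0 (∧-intro #1 #0)))))))

  ∀<¬-as-¬∃< : (t : Term n) {φ : Form (suc n)} → T ⊢ ∀<' t (¬' φ) ⇒ ¬' (∃<' t φ)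
  ∀<¬-as-¬∃< t = ⊩⇒⊢ (⇒-intro (⇒-intro (∃-elim #0 (app (app (∀-elim-var0 #2) (∧-elim₁ #0)) (∧-elim₂ #0)))))

  ∃<-□-complete : (t : Term n) {φ : Form (suc n)} → □-complete φ → □-complete (∃<' t φ)
  ∃<-□-complete t c = ∃-□-complete (∧-□-complete (≼-□-complete (S v0) (wkT t)) c)

  wk-≐-wk₁ : {φ : Form (suc n)} {Γ : List (Form (suc (suc n)))} → Γ ⊩ v1 ≐ v0 → Γ ⊩ wk φ → Γ ⊩ wk₁ φ
  wk-≐-wk₁ {φ = φ} e p = ⊩-cast (inst-exts-shift²-var0 φ)
    (≐-elim (subst (exts shift²) φ) e (⊩-cast (sym (inst-exts-shift²-var1 φ)) p))

  -- By induction on y, ∀x<y φ(x) → □ ∀x<y φ(x); the step adds φ(y), which is □-complete.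
  ∀<-□-complete : ∀ {n} (t : Term n) {φ : Form (suc n)} → □-complete φ → □-complete (∀<' t φ)
  ∀<-□-complete {n} t {φ} c =
    cast (cong (λ χ → ∀<' t χ ⇒ □ (∀<' t χ)) (subst-exts-single-wk₁ t φ))
         (⊩⇒⊢ (∀-elim t (thm (⊢-induction (below ⇒ □ below) base
           (cast (cong (λ χ → (below ⇒ □ below) ⇒ ∀<' (S v0) χ ⇒ □ (∀<' (S v0) χ))
                       (sym (subst-exts-wk₁ succₛ φ))) step)))))
    where
    below below-suc : Form (suc n)
    below = ∀<' v0 (wk₁ φ)
    below-suc = ∀<' (S v0) (wk₁ φ)

    base : T ⊢ inst (below ⇒ □ below) 𝟎
    base = ⊩⇒⊢ (⇒-intro (□-intro (∀-intro (⇒-intro (ex-falso (n≮0 #0))))))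

    below-suc⇒below : T ⊢ below-suc ⇒ below
    below-suc⇒below = ⊩⇒⊢ (⇒-intro (∀-intro (⇒-intro (app (∀-elim-var0 #1) (m≤n⇒m≤1+n #0)))))

    below-suc⇒φ : T ⊢ below-suc ⇒ φ
    below-suc⇒φ = ⊩⇒⊢ (⇒-intro (⊩-cast (inst-wk₁ φ) (app (∀-elim v0 #0) (≼-refl (S v0)))))

    below∧φ⇒below-suc : T ⊢ below ∧' φ ⇒ below-suc
    below∧φ⇒below-suc = ⊩⇒⊢ (⇒-intro (∀-intro (⇒-intro (∨-elim (m≤n⇒m<n∨m≡n (s≤s⁻¹ #0))
      (app (∀-elim-var0 (∧-elim₁ #2)) #0)
      (wk-≐-wk₁ (≐-sym #0) (∧-elim₂ #2))))))

    step : T ⊢ (below ⇒ □ below) ⇒ below-suc ⇒ □ below-suc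
    step = ⊩⇒⊢ (⇒-intro (⇒-intro (□-map (thm below∧φ⇒below-suc)
      (□-∧ (app #1 (app (thm below-suc⇒below) #0)) (app (thm c) (app (thm below-suc⇒φ) #0))))))

  mutual
    Δ0-□-complete : Δ0 φ → □-complete φ
    Δ0-□-complete (d-≐ {t = t} {u}) = ≐-□-complete t u
    Δ0-□-complete (d-≼ {t = t} {u}) = ≼-□-complete t u
    Δ0-□-complete d-⊥ = ⊥-□-complete
    Δ0-□-complete (d-⇒ δ ε) =
      □-complete-⇔ ¬∨-as-⇒ ⇒-as-¬∨ (∨-□-complete (Δ0-¬-□-complete δ) (Δ0-□-complete ε))
    Δ0-□-complete (d-∧ δ ε) = ∧-□-complete (Δ0-□-complete δ) (Δ0-□-complete ε)
    Δ0-□-complete (d-∨ δ ε) = ∨-□-complete (Δ0-□-complete δ) (Δ0-□-complete ε)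
    Δ0-□-complete (d-∀< {t = t} δ) = ∀<-□-complete t (Δ0-□-complete δ)
    Δ0-□-complete (d-∃< {t = t} δ) = ∃<-□-complete t (Δ0-□-complete δ)

    Δ0-¬-□-complete : Δ0 φ → □-complete (¬' φ)
    Δ0-¬-□-complete (d-≐ {t = t} {u}) = ≢-□-complete t u
    Δ0-¬-□-complete (d-≼ {t = t} {u}) = ≰-□-complete t u
    Δ0-¬-□-complete d-⊥ = ⊢⇒□-complete ⊢-id
    Δ0-¬-□-complete (d-⇒ δ ε) =
      □-complete-⇔ ∧¬-as-¬⇒ ¬⇒-as-∧¬ (∧-□-complete (Δ0-□-complete δ) (Δ0-¬-□-complete ε))
    Δ0-¬-□-complete (d-∧ δ ε) =
      □-complete-⇔ ¬∨¬-as-¬∧ ¬∧-as-¬∨¬ (∨-□-complete (Δ0-¬-□-complete δ) (Δ0-¬-□-complete ε))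
    Δ0-¬-□-complete (d-∨ δ ε) =
      □-complete-⇔ ¬∧¬-as-¬∨ ¬∨-as-¬∧¬ (∧-□-complete (Δ0-¬-□-complete δ) (Δ0-¬-□-complete ε))
    Δ0-¬-□-complete (d-∀< {t = t} δ) =
      □-complete-⇔ (∃<¬-as-¬∀< t) (¬∀<-as-∃<¬ t) (∃<-□-complete t (Δ0-¬-□-complete δ))
    Δ0-¬-□-complete (d-∃< {t = t} δ) =
      □-complete-⇔ (∀<¬-as-¬∃< t) (¬∃<-as-∀<¬ t) (∀<-□-complete t (Δ0-¬-□-complete δ))

  Σ1-□-complete : Σ1 φ → □-complete φ
  Σ1-□-complete (s-Δ0 δ) = Δ0-□-complete δ
  Σ1-□-complete (s-∃ σ) = ∃-□-complete (Σ1-□-complete σ)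

  Σ1□-□-complete : Σ1□ φ → □-complete φ
  Σ1□-□-complete (b-Σ1 σ) = Σ1-□-complete σ
  Σ1□-□-complete b-□ = ⊢-4
  Σ1□-□-complete (b-∧ σ τ) = ∧-□-complete (Σ1□-□-complete σ) (Σ1□-□-complete τ)
  Σ1□-□-complete (b-∨ σ τ) = ∨-□-complete (Σ1□-□-complete σ) (Σ1□-□-complete τ)
  Σ1□-□-complete (b-∃ σ) = ∃-□-complete (Σ1□-□-complete σ)
  Σ1□-□-complete (b-∀< {t = t} σ) = ∀<-□-complete t (Σ1□-□-complete σ)

  MDP⇒Σ1□-DP : MDP T → Σ1□-DP T
  MDP⇒Σ1□-DP mdp φ ψ φ∈Σ1□ ψ∈Σ1□ ⊢φ∨ψ = mdp φ ψ (⊩⇒⊢ (∨-elim (thm ⊢φ∨ψ)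
    (∨-intro₁ (app (thm (Σ1□-□-complete φ∈Σ1□)) #0))
    (∨-intro₂ (app (thm (Σ1□-□-complete ψ∈Σ1□)) #0))))

  MEP⇒Σ1□-EP : MEP T → Σ1□-EP T
  MEP⇒Σ1□-EP mep φ φ∈Σ1□ ⊢∃φ =
    mep φ (⊩⇒⊢ (∃-elim (thm ⊢∃φ) (∃-intro-var0 (app (thm (Σ1□-□-complete φ∈Σ1□)) #0))))

proposition5p11 : (T : Sentence → Set) → RE T → ExtendsPAK4 T →
    (MDP T → Σ1□-DP T) × (MEP T → Σ1□-EP T)
proposition5p11 T _ ext = PAK4.MDP⇒Σ1□-DP ext , PAK4.MEP⇒Σ1□-EP ext
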